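{- It is decidable, given a finite relational structure $\mathbb{H}$, whether $\mathbb{H}$ has an idempotent polymorphism that is not a projection.
   Context: A relational structure has a nonempty finite universe $H$ and finitely many relations given by explicit lists of tuples. A $k$-ary polymorphism is an operation $H^k\to H$ that, applied coordinatewise to $k$ tuples of any relation, yields a tuple of that relation; it is idempotent if $f(x,\dots,x)=x$ for all $x$, and a projection if $f(x_1,\dots,x_k)=x_i$ for some fixed $i$. -}

module Defs where

open import Data.Nat using (ℕ; suc)
open import Data.Fin using (Fin)
open import Data.Vec using (Vec; tabulate; lookup)
open import Data.List using (List)
open import Data.List.Membership.Propositional using (_∈_)
open import Data.List.Relation.Unary.All using (All)
open import Data.Product using (Σ; ∃; ∃-syntax; _×_)
open import Relation.Binary.PropositionalEquality using (_≡_)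
open import Relation.Nullary using (¬_)

record Relation (u : ℕ) : Set where
  constructor rel
  field
    arity  : ℕ
    tuples : List (Vec (Fin u) arity)

record Structure : Set where
  constructor struct
  field
    size      : ℕ
    relations : List (Relation (suc size))

  Univ : Set
  Univ = Fin (suc size)

open Structure public

Operation : Structure → ℕ → Set
Operation H k = (Fin k → Univ H) → Univ H

Preserves : (H : Structure) {k : ℕ} → Operation H k → Relation (suc (size H)) → Set
Preserves H {k} f R =
  (t : Fin k → Vec (Univ H) (Relation.arity R)) →
  (∀ i → t i ∈ Relation.tuples R) →
  tabulate (λ j → f (λ i → lookup (t i) j)) ∈ Relation.tuples R

IsPolymorphism : (H : Structure) {k : ℕ} → Operation H k → Set
IsPolymorphism H f = All (Preserves H f) (relations H)

IsIdempotent : (H : Structure) {k : ℕ} → Operation H k → Set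
IsIdempotent H f = ∀ x → f (λ _ → x) ≡ x

IsProjection : (H : Structure) {k : ℕ} → Operation H k → Set
IsProjection H {k} f = ∃[ i ] (∀ (x : Fin k → Univ H) → f x ≡ x i)

HasNontrivialIdempotentPolymorphism : Structure → Set
HasNontrivialIdempotentPolymorphism H =
  ∃[ k ] Σ (Operation H (suc k)) λ f →
    IsPolymorphism H f × IsIdempotent H f × ¬ IsProjection H f

-- For |H| = 1 every operation is a projection.  Otherwise it suffices to search the arities
-- up to |H| + 5: if none of them carries a nontrivial idempotent polymorphism, every
-- idempotent polymorphism f is a projection, by induction on the arity.  Beyond the bound all
-- identification minors of f are projections by induction, so by Świerczkowski's lemma they
-- all project onto one common coordinate s, and since f has more arguments than H has
-- elements, every input identifies two of them, whence f x = x s.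
-- An Agda operation need not respect pointwise equality of its argument functions.  That an
-- idempotent polymorphism does is shown by probing it with polymorphisms of arity |H|, which
-- are projections because |H| lies below the bound.

module Submission where

open import Defs
open import Data.Nat using (ℕ; zero; suc; _+_; _<_; _≤_; z≤n; s≤s; _<?_)
open import Data.Nat.Properties using (anyUpTo?; ≮⇒≥; m≤m+n; m≤n+m; n≤1+n; <⇒≤; <-trans; n<1+n; ≤-trans)
open import Data.Fin using (Fin; zero; suc; _≟_; punchIn; punchOut)
open import Data.Fin.Patterns using (0F; 1F; 2F; 3F)
open import Data.Fin.Properties using (any?; all?; pigeonhole; punchIn-punchOut; <⇒≢)
open import Data.Vec using (Vec; []; _∷_; tabulate; lookup; allFin)
open import Data.Vec.Properties using (lookup∘tabulate; tabulate∘lookup; tabulate-cong; lookup-allFin)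
import Data.Vec.Properties as Vec
open import Data.Vec.Functional using () renaming (_∷_ to _∷ᶠ_)
open import Data.List using (List; []; _∷_; length)
open import Data.List.Membership.Propositional using (_∈_; _∉_)
import Data.List.Membership.DecPropositional as DecMembership
open import Data.List.Relation.Unary.Any using (here; there; index)
import Data.List.Relation.Unary.Any as Any
open import Data.List.Relation.Unary.Any.Properties using (lookup-index)
open import Data.List.Relation.Unary.All using (All; []; _∷_)
import Data.List.Relation.Unary.All as All
open import Data.List.Relation.Unary.All.Properties using (All¬⇒¬Any; ¬Any⇒All¬)
open import Data.Product using (∃; ∃₂; _×_; _,_; proj₁; proj₂)
open import Function using (_∘_; _⇔_; mk⇔; Equivalence)
open import Function.Definitions using (Congruent)
open import Level using (0ℓ)
open import Relation.Unary using (Pred; Decidable)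
open import Relation.Nullary using (Dec; yes; no; ¬_; contradiction)
open import Relation.Nullary.Decidable using (map′; _×-dec_; _→-dec_; ¬?; decidable-stable)
open import Relation.Binary.PropositionalEquality
  using (_≡_; _≢_; _≗_; refl; sym; trans; cong; subst; ≢-sym; module ≡-Reasoning)

Searchable : Set → Set₁
Searchable A = ∀ {P : Pred A 0ℓ} → Decidable P → Dec (∃ P)

searchFin : ∀ {n} → Searchable (Fin n)
searchFin = any?

searchVec : ∀ {A} → Searchable A → ∀ m → Searchable (Vec A m)
searchVec S zero    P? = map′ ([] ,_) (λ { ([] , p) → p }) (P? [])
searchVec S (suc m) P? =
  map′ (λ { (a , v , p) → a ∷ v , p }) (λ { (a ∷ v , p) → a , v , p })
       (S (λ a → searchVec S m (P? ∘ (a ∷_))))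

∀-dec : ∀ {A} → Searchable A → ∀ {P : Pred A 0ℓ} → Decidable P → Dec (∀ a → P a)
∀-dec S P? with S (¬? ∘ P?)
... | yes (a , ¬pa) = no λ p → ¬pa (p a)
... | no ¬∃¬        = yes λ a → decidable-stable (P? a) (λ ¬pa → ¬∃¬ (a , ¬pa))

∀-fun-dec : ∀ {A} → Searchable A → ∀ k {P : Pred (Fin k → A) 0ℓ} →
            (∀ {x y} → x ≗ y → P x → P y) → Decidable P → Dec (∀ x → P x)
∀-fun-dec S k resp P? =
  map′ (λ p x → resp (lookup∘tabulate x) (p (tabulate x))) (λ p → p ∘ lookup)
       (∀-dec (searchVec S k) (P? ∘ lookup))

Table : ℕ → ℕ → Set
Table n zero    = Fin n
Table n (suc k) = Vec (Table n k) n

apply : ∀ {n} k → Table n k → (Fin k → Fin n) → Fin n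
apply zero    T x = T
apply (suc k) T x = apply k (lookup T (x zero)) (x ∘ suc)

apply-cong : ∀ {n} k (T : Table n k) → Congruent _≗_ _≡_ (apply k T)
apply-cong zero    T x≗y = refl
apply-cong (suc k) T x≗y rewrite x≗y zero = apply-cong k _ (x≗y ∘ suc)

table : ∀ {n} k → ((Fin k → Fin n) → Fin n) → Table n k
table zero    g = g (λ ())
table (suc k) g = tabulate (λ a → table k (λ z → g (a ∷ᶠ z)))

apply-table : ∀ {n} k (g : (Fin k → Fin n) → Fin n) → Congruent _≗_ _≡_ g →
              apply k (table k g) ≗ g
apply-table zero    g g-cong x = g-cong (λ ())
apply-table (suc k) g g-cong x = begin
  apply k (lookup (table (suc k) g) (x zero)) (x ∘ suc)
    ≡⟨ cong (λ T → apply k T (x ∘ suc)) (lookup∘tabulate _ (x zero)) ⟩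
  apply k (table k (λ z → g (x zero ∷ᶠ z))) (x ∘ suc)
    ≡⟨ apply-table k _ (λ z≗z′ → g-cong λ { zero → refl ; (suc i) → z≗z′ i }) (x ∘ suc) ⟩
  g (x zero ∷ᶠ (x ∘ suc))
    ≡⟨ g-cong (λ { zero → refl ; (suc i) → refl }) ⟩
  g x ∎
  where open ≡-Reasoning

searchTable : ∀ n k → Searchable (Table n k)
searchTable n zero    = searchFin
searchTable n (suc k) = searchVec (searchTable n k) n

-- The entries agree definitionally, so no congruence of f is needed.
tabulate-lookup-tabulate : ∀ {A B : Set} {k m} (f : (Fin k → A) → B) (g : Fin m → Fin k → A) →
  tabulate (λ j → f (λ i → lookup (tabulate (λ j′ → g j′ i)) j)) ≡ tabulate (λ j → f (g j))
tabulate-lookup-tabulate {m = zero}  f g = refl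
tabulate-lookup-tabulate {m = suc m} f g = cong (f (g zero) ∷_) (tabulate-lookup-tabulate f (g ∘ suc))

NontrivialIdempotentPolymorphism : (H : Structure) {k : ℕ} → Operation H k → Set
NontrivialIdempotentPolymorphism H f = IsPolymorphism H f × IsIdempotent H f × ¬ IsProjection H f

module _ (H : Structure) where

  private
    U : Set
    U = Univ H
    n : ℕ
    n = suc (size H)

  module _ {k} {f g : Operation H k} (f≗g : f ≗ g) where

    isPolymorphism-resp : IsPolymorphism H f → IsPolymorphism H g
    isPolymorphism-resp = All.map λ {R} pres t t∈ →
      subst (_∈ Relation.tuples R) (tabulate-cong (λ j → f≗g _)) (pres t t∈)

    isIdempotent-resp : IsIdempotent H f → IsIdempotent H g
    isIdempotent-resp idem a = trans (sym (f≗g _)) (idem a)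

    isProjection-resp : IsProjection H f → IsProjection H g
    isProjection-resp (i , proj) = i , λ x → trans (sym (f≗g x)) (proj x)

  nontrivialIdempotentPolymorphism-resp : ∀ {k} {f g : Operation H k} → f ≗ g →
    NontrivialIdempotentPolymorphism H f → NontrivialIdempotentPolymorphism H g
  nontrivialIdempotentPolymorphism-resp f≗g (pol , idem , ¬proj) =
    isPolymorphism-resp f≗g pol , isIdempotent-resp f≗g idem , ¬proj ∘ isProjection-resp (sym ∘ f≗g)

  isIdempotent? : ∀ {k} (f : Operation H k) → Dec (IsIdempotent H f)
  isIdempotent? f = all? (λ a → f (λ _ → a) ≟ a)

  isProjection? : ∀ {k} (f : Operation H k) → Congruent _≗_ _≡_ f → Dec (IsProjection H f)
  isProjection? {k} f f-cong = any? λ i →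
    ∀-fun-dec searchFin k (λ x≗y fx≡xi → trans (sym (f-cong x≗y)) (trans fx≡xi (x≗y i)))
              (λ x → f x ≟ x i)

  preserves? : ∀ {k} (f : Operation H k) → Congruent _≗_ _≡_ f → ∀ R → Dec (Preserves H f R)
  preserves? {k} f f-cong (rel m tuples) =
    ∀-fun-dec (searchVec searchFin m) k resp
      (λ t → all? (λ i → t i ∈? tuples) →-dec (_ ∈? tuples))
    where
    open DecMembership (Vec.≡-dec _≟_) using (_∈?_)
    resp : ∀ {t t′ : Fin k → Vec U m} → t ≗ t′ →
           ((∀ i → t i ∈ tuples) → tabulate (λ j → f (λ i → lookup (t i) j)) ∈ tuples) →
           ((∀ i → t′ i ∈ tuples) → tabulate (λ j → f (λ i → lookup (t′ i) j)) ∈ tuples)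
    resp t≗t′ pres t′∈ =
      subst (_∈ tuples) (tabulate-cong λ j → f-cong λ i → cong (λ v → lookup v j) (t≗t′ i))
            (pres λ i → subst (_∈ tuples) (sym (t≗t′ i)) (t′∈ i))

  isPolymorphism? : ∀ {k} (f : Operation H k) → Congruent _≗_ _≡_ f → Dec (IsPolymorphism H f)
  isPolymorphism? f f-cong = All.all? (preserves? f f-cong) (relations H)

  nontrivialIdempotentPolymorphism? : ∀ {k} (f : Operation H k) → Congruent _≗_ _≡_ f →
                                      Dec (NontrivialIdempotentPolymorphism H f)
  nontrivialIdempotentPolymorphism? f f-cong =
    isPolymorphism? f f-cong ×-dec isIdempotent? f ×-dec ¬? (isProjection? f f-cong)

  HasNontrivialBelow : ℕ → Set
  HasNontrivialBelow N = ∃ λ M → M < N × ∃ λ (f : Operation H (suc M)) →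
    Congruent _≗_ _≡_ f × NontrivialIdempotentPolymorphism H f

  hasNontrivialBelow? : ∀ N → Dec (HasNontrivialBelow N)
  hasNontrivialBelow? = anyUpTo? λ M →
    map′ (λ { (T , nip) → apply (suc M) T , apply-cong (suc M) T , nip })
         (λ { (f , f-cong , nip) → table (suc M) f ,
              nontrivialIdempotentPolymorphism-resp (sym ∘ apply-table (suc M) f f-cong) nip })
         (searchTable n (suc M) λ T →
            nontrivialIdempotentPolymorphism? (apply (suc M) T) (apply-cong (suc M) T))

  pointwiseMinor-isPolymorphism : ∀ {k m} (f : Operation H k) (σ : Fin k → Fin m)
    (ρ : (Fin m → U) → Fin k → U) → (∀ y → ρ y ≗ y ∘ σ) →
    IsPolymorphism H f → IsPolymorphism H (f ∘ ρ)
  pointwiseMinor-isPolymorphism f σ ρ ρ≗ = All.map preserves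
    where
    preserves : ∀ {R} → Preserves H f R → Preserves H (f ∘ ρ) R
    preserves {rel m tuples} f-pres t t∈ =
      subst (_∈ tuples) (tabulate-lookup-tabulate f inputs)
            (f-pres (λ i → tabulate (λ j → inputs j i)) column∈)
      where
      inputs : Fin m → _ → U
      inputs j = ρ (λ p → lookup (t p) j)
      column∈ : ∀ i → tabulate (λ j → inputs j i) ∈ tuples
      column∈ i = subst (_∈ tuples)
        (sym (trans (tabulate-cong (λ j → ρ≗ _ i)) (tabulate∘lookup (t (σ i))))) (t∈ (σ i))

-- Identification minors

identify : ∀ {k} {i j : Fin (suc k)} → i ≢ j → Fin (suc k) → Fin k
identify {j = j} i≢j l with l ≟ j
... | yes _   = punchOut (i≢j ∘ sym)
... | no l≢j = punchOut (l≢j ∘ sym)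

punchIn-identify : ∀ {A : Set} {k} {i j : Fin (suc k)} (i≢j : i ≢ j) {x : Fin (suc k) → A} →
                   x i ≡ x j → x ∘ punchIn j ∘ identify i≢j ≗ x
punchIn-identify {j = j} i≢j {x} xi≡xj l with l ≟ j
... | yes refl = trans (cong x (punchIn-punchOut _)) xi≡xj
... | no _     = cong x (punchIn-punchOut _)

-- The identification minor of f merging i and j is the projection onto r.
Collapses : ∀ {U : Set} {K} → ((Fin K → U) → U) → Fin K → Fin K → Fin K → Set
Collapses f i j r = ∀ x → x i ≡ x j → f x ≡ x r

PairwiseCollapsing : ∀ {U : Set} {K} → ((Fin K → U) → U) → Set
PairwiseCollapsing f = ∀ {i j} → i ≢ j → ∃ (Collapses f i j)

identificationMinor-collapses : ∀ (H : Structure) {k} {f : Operation H (suc k)} {i j} (i≢j : i ≢ j) →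
  Congruent _≗_ _≡_ f → IsProjection H (f ∘ (_∘ identify i≢j)) → ∃ (Collapses f i j)
identificationMinor-collapses H {f = f} {j = j} i≢j f-cong (q , proj) = punchIn j q , λ x xi≡xj →
  trans (f-cong (sym ∘ punchIn-identify i≢j xi≡xj)) (proj (x ∘ punchIn j))

collapsing-projection : ∀ {n K} {f : (Fin K → Fin n) → Fin n} {s} → n < K →
                        (∀ {a b} → a ≢ b → Collapses f a b s) → ∀ x → f x ≡ x s
collapsing-projection n<K collapse x with pigeonhole n<K x
... | i , j , i<j , xi≡xj = collapse (<⇒≢ i<j) x xi≡xj

-- Świerczkowski's lemma

indicator : ∀ {A U : Set} {P : Pred A 0ℓ} → Decidable P → (inside outside : U) → A → U
indicator P? inside outside a with P? a
... | yes _ = inside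
... | no _  = outside

module _ {A U : Set} {P : Pred A 0ℓ} (P? : Decidable P) {inside outside : U} where

  indicator-inside : ∀ {a} → P a → indicator P? inside outside a ≡ inside
  indicator-inside {a} pa with P? a
  ... | yes _  = refl
  ... | no ¬pa = contradiction pa ¬pa

  indicator-outside : ∀ {a} → ¬ P a → indicator P? inside outside a ≡ outside
  indicator-outside {a} ¬pa with P? a
  ... | yes pa = contradiction pa ¬pa
  ... | no _   = refl

  indicator-both-inside : ∀ {a b} → P a → P b →
    indicator P? inside outside a ≡ indicator P? inside outside b
  indicator-both-inside pa pb = trans (indicator-inside pa) (sym (indicator-inside pb))

  indicator-both-outside : ∀ {a b} → ¬ P a → ¬ P b →
    indicator P? inside outside a ≡ indicator P? inside outside b
  indicator-both-outside ¬pa ¬pb = trans (indicator-outside ¬pa) (sym (indicator-outside ¬pb))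

  indicator-transport : outside ≢ inside → ∀ {a b} →
    indicator P? inside outside a ≡ indicator P? inside outside b → P a → P b
  indicator-transport out≢in {a} {b} χa≡χb pa = decidable-stable (P? b) λ ¬pb →
    out≢in (trans (sym (indicator-outside ¬pb)) (trans (sym χa≡χb) (indicator-inside pa)))

fresh : ∀ {K} (L : List (Fin K)) → length L < K → ∃ λ c → All (c ≢_) L
fresh L |L|<K = decidable-stable (any? λ c → All.all? (λ l → ¬? (c ≟ l)) L) λ ¬found →
  let member : ∀ c → c ∈ L
      member c = decidable-stable (Any.any? (c ≟_) L) (¬found ∘ (c ,_) ∘ ¬Any⇒All¬ L)
      (i , j , i<j , same-index) = pigeonhole |L|<K (index ∘ member)
  in <⇒≢ i<j (begin
       i                                 ≡⟨ lookup-index (member i) ⟩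
       Data.List.lookup L (index (member i)) ≡⟨ cong (Data.List.lookup L) same-index ⟩
       Data.List.lookup L (index (member j)) ≡⟨ lookup-index (member j) ⟨
       j                                 ∎)
  where open ≡-Reasoning

module _ {U : Set} {K} {f : (Fin K → U) → U} where

  collapses-agree : ∀ {i j r a b s} {x : Fin K → U} → Collapses f i j r → Collapses f a b s →
                    x i ≡ x j → x a ≡ x b → x r ≡ x s
  collapses-agree {x = x} cr cs xi≡xj xa≡xb = trans (sym (cr x xi≡xj)) (cs x xa≡xb)

  collapses-within-pair : ∀ {a b r s} → Collapses f a b r →
    r ∈ a ∷ b ∷ [] → s ∈ a ∷ b ∷ [] → Collapses f a b s
  collapses-within-pair {a} {b} cr r∈ab s∈ab x xa≡xb =
    trans (cr x xa≡xb) (trans (value r∈ab) (sym (value s∈ab)))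
    where
    value : ∀ {l} → l ∈ a ∷ b ∷ [] → x l ≡ x a
    value (here refl)         = refl
    value (there (here refl)) = sym xa≡xb

module _ {U : Set} {u₀ u₁ : U} (u₀≢u₁ : u₀ ≢ u₁) {K} {f : (Fin K → U) → U} where

  collapse-pinned : ∀ {i j r a b s} → Collapses f i j r → Collapses f a b s →
                    s ≢ i → s ≢ j → s ≢ a → s ≢ b → r ≡ s
  collapse-pinned {s = s} cr cs s≢i s≢j s≢a s≢b = sym (indicator-transport (s ≟_) u₀≢u₁
    (collapses-agree cs cr (indicator-both-outside (s ≟_) s≢a s≢b)
                           (indicator-both-outside (s ≟_) s≢i s≢j)) refl)

  collapse-pair : ∀ {a b r c d s} → Collapses f a b r → Collapses f c d s →
                  c ∉ a ∷ b ∷ [] → d ∉ a ∷ b ∷ [] → r ∈ a ∷ b ∷ [] ⇔ s ∈ a ∷ b ∷ []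
  collapse-pair {a} {b} cr cs c∉ab d∉ab =
    mk⇔ (indicator-transport P? u₀≢u₁ χr≡χs) (indicator-transport P? u₀≢u₁ (sym χr≡χs))
    where
    P? = λ l → DecMembership._∈?_ _≟_ l (a ∷ b ∷ [])
    χr≡χs = collapses-agree cr cs (indicator-both-inside P? (here refl) (there (here refl)))
                                  (indicator-both-outside P? c∉ab d∉ab)

  collapse-transfer : ∀ {a b r c d s} → Collapses f a b r → Collapses f c d s →
    c ∉ a ∷ b ∷ [] → d ∉ a ∷ b ∷ [] → s ≢ c → s ≢ d → Collapses f a b s
  collapse-transfer {a} {b} {s = s} cr cs c∉ab d∉ab s≢c s≢d
    with DecMembership._∈?_ _≟_ s (a ∷ b ∷ [])
  ... | yes s∈ab =
    collapses-within-pair cr (Equivalence.from (collapse-pair cr cs c∉ab d∉ab) s∈ab) s∈ab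
  ... | no s∉ab  = subst (Collapses f a b)
                     (collapse-pinned cr cs (s∉ab ∘ here) (s∉ab ∘ there ∘ here) s≢c s≢d) cr

collapse-outside-pair : ∀ {U : Set} {u₀ u₁ : U} → u₀ ≢ u₁ → ∀ {K} {f : (Fin K → U) → U} → 4 ≤ K →
  PairwiseCollapsing f → ∃₂ λ e₁ e₂ → ∃ λ s → s ∉ e₁ ∷ e₂ ∷ [] × Collapses f e₁ e₂ s
collapse-outside-pair u₀≢u₁ (s≤s (s≤s (s≤s (s≤s _)))) pc with pc {0F} {1F} (λ ())
... | r₀ , c₀ with DecMembership._∈?_ _≟_ r₀ (0F ∷ 1F ∷ [])
...   | no r₀∉ = 0F , 1F , r₀ , r₀∉ , c₀
...   | yes r₀∈ with pc {2F} {3F} (λ ())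
...     | r₁ , c₁ =
  2F , 3F , r₁ , disjoint (Equivalence.to (collapse-pair u₀≢u₁ c₀ c₁ 2∉ 3∉) r₀∈) , c₁
  where
  2∉ : 2F ∉ 0F ∷ 1F ∷ []
  2∉ (here ())
  2∉ (there (here ()))
  3∉ : 3F ∉ 0F ∷ 1F ∷ []
  3∉ (here ())
  3∉ (there (here ()))
  disjoint : ∀ {l} → l ∈ 0F ∷ 1F ∷ [] → l ∉ 2F ∷ 3F ∷ []
  disjoint (here refl)         (here ())
  disjoint (here refl)         (there (here ()))
  disjoint (there (here refl)) (here ())
  disjoint (there (here refl)) (there (here ()))

-- A pair {c, d} disjoint from {a, b} and avoiding s first inherits s from {e₁, e₂}
-- and then passes it on to {a, b}.
collapse-everywhere : ∀ {U : Set} {u₀ u₁ : U} → u₀ ≢ u₁ → ∀ {K} {f : (Fin K → U) → U} → 4 < K →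
  PairwiseCollapsing f → ∀ {e₁ e₂ s} → s ∉ e₁ ∷ e₂ ∷ [] → Collapses f e₁ e₂ s →
  ∀ {a b} → a ≢ b → Collapses f a b s
collapse-everywhere u₀≢u₁ {f = f} 4<K pc {s = s} s∉e ce {a} {b} a≢b
  with fresh (a ∷ b ∷ s ∷ []) (<-trans (n<1+n 3) 4<K)
... | c , c≢a ∷ c≢b ∷ c≢s ∷ [] with fresh (c ∷ a ∷ b ∷ s ∷ []) 4<K
... | d , d≢c ∷ d≢a ∷ d≢b ∷ d≢s ∷ [] with pc (≢-sym d≢c)
... | t , ct = collapse-transfer u₀≢u₁ (proj₂ (pc a≢b)) cs
                 (All¬⇒¬Any (c≢a ∷ c≢b ∷ [])) (All¬⇒¬Any (d≢a ∷ d≢b ∷ [])) (≢-sym c≢s) (≢-sym d≢s)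
  where
  cs : Collapses f c d s
  cs = subst (Collapses f c d)
         (collapse-pinned u₀≢u₁ ct ce (≢-sym c≢s) (≢-sym d≢s) (s∉e ∘ here) (s∉e ∘ there ∘ here)) ct

swierczkowski : ∀ {U : Set} {u₀ u₁ : U} → u₀ ≢ u₁ → ∀ {K} {f : (Fin K → U) → U} → 4 < K →
  PairwiseCollapsing f → ∃ λ s → ∀ {a b} → a ≢ b → Collapses f a b s
swierczkowski u₀≢u₁ 4<K pc with collapse-outside-pair u₀≢u₁ (<⇒≤ 4<K) pc
... | e₁ , e₂ , s , s∉e , ce = s , collapse-everywhere u₀≢u₁ 4<K pc s∉e ce

-- Congruence of idempotent polymorphisms

IsConstant : ∀ {A : Set} {n} → Vec A (suc n) → Set
IsConstant c = ∀ u → lookup c u ≡ lookup c zero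

isConstant? : ∀ {m n} (c : Vec (Fin m) (suc n)) → Dec (IsConstant c)
isConstant? c = all? λ u → lookup c u ≟ lookup c zero

separated⇒¬IsConstant : ∀ {A : Set} {n} {c : Vec A (suc n)} {u v} →
                        lookup c u ≢ lookup c v → ¬ IsConstant c
separated⇒¬IsConstant cu≢cv const = cu≢cv (trans (const _) (sym (const _)))

module _ (H : Structure) {a b : Univ H} (a≢b : a ≢ b)
  (arity-|H|-isProjection : ∀ (g : Operation H (suc (size H))) → Congruent _≗_ _≡_ g →
     IsPolymorphism H g → IsIdempotent H g → IsProjection H g) where

  private
    U : Set
    U = Univ H
    n : ℕ
    n = suc (size H)

  allFin-nonconstant : ¬ IsConstant (allFin n)
  allFin-nonconstant = separated⇒¬IsConstant {c = allFin n} {u = a} {v = b} λ eq →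
    a≢b (trans (sym (lookup-allFin a)) (trans eq (lookup-allFin b)))

  -- probe z is the n-ary minor y ↦ f (y ∘ x), except that on the identity it feeds f the
  -- function z and on constant inputs a literally constant function.  Pointwise it is still
  -- that minor when x ≗ z, so it is a congruent idempotent polymorphism of arity |H|.
  module Probe {k} (f : Operation H k) (x : Fin k → U) where

    input : (Fin k → U) → Vec U n → Fin k → U
    input z c with isConstant? c | Vec.≡-dec _≟_ c (allFin n)
    ... | yes _ | _     = λ _ → lookup c zero
    ... | no _  | yes _ = z
    ... | no _  | no _  = λ i → lookup c (x i)

    probe : (Fin k → U) → Operation H n
    probe z y = f (input z (tabulate y))

    input-pointwise : ∀ {z} → x ≗ z → ∀ c → input z c ≗ (λ i → lookup c (x i))
    input-pointwise x≗z c i with isConstant? c | Vec.≡-dec _≟_ c (allFin n)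
    ... | yes const | _        = sym (const (x i))
    ... | no _      | yes refl = trans (sym (x≗z i)) (sym (lookup-allFin (x i)))
    ... | no _      | no _     = refl

    input-constant : ∀ z v → input z (tabulate (λ _ → v)) ≡ (λ _ → v)
    input-constant z v with isConstant? (tabulate {n = n} (λ _ → v))
    ... | yes _     = refl
    ... | no ¬const = contradiction (lookup∘tabulate _) ¬const

    input-allFin : ∀ z → input z (allFin n) ≡ z
    input-allFin z with isConstant? (allFin n) | Vec.≡-dec _≟_ (allFin n) (allFin n)
    ... | yes const | _      = contradiction const allFin-nonconstant
    ... | no _      | yes _  = refl
    ... | no _      | no ≢id = contradiction refl ≢id

    input-generic : ∀ z {c} → ¬ IsConstant c → c ≢ allFin n → input z c ≡ (λ i → lookup c (x i))
    input-generic z {c} ¬const ≢id with isConstant? c | Vec.≡-dec _≟_ c (allFin n)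
    ... | yes const | _       = contradiction const ¬const
    ... | no _      | yes ≡id = contradiction ≡id ≢id
    ... | no _      | no _    = refl

    probe-congruent : ∀ z → Congruent _≗_ _≡_ (probe z)
    probe-congruent z y≗y′ = cong (f ∘ input z) (tabulate-cong y≗y′)

    probe-isIdempotent : IsIdempotent H f → ∀ z → IsIdempotent H (probe z)
    probe-isIdempotent idem z v = trans (cong f (input-constant z v)) (idem v)

    probe-isPolymorphism : IsPolymorphism H f → ∀ {z} → x ≗ z → IsPolymorphism H (probe z)
    probe-isPolymorphism pol {z} x≗z = pointwiseMinor-isPolymorphism H f x (input z ∘ tabulate)
      (λ y i → trans (input-pointwise x≗z (tabulate y) i) (lookup∘tabulate y (x i))) pol

    probe-identity : ∀ z → probe z (λ u → u) ≡ f z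
    probe-identity z = cong f (input-allFin z)

    -- Away from constant inputs and the identity the two probes coincide; χ is such an input
    -- separating q from q′.
    probe-coordinates-agree : ∀ {z z′ q q′} → (∀ y → probe z y ≡ y q) → (∀ y → probe z′ y ≡ y q′) →
                              q ≡ q′
    probe-coordinates-agree {z} {z′} {q} {q′} proj proj′ = decidable-stable (q ≟ q′) λ q≢q′ →
      let χ = indicator (_≟ q) q′ q
          χq≡q′ : χ q ≡ q′
          χq≡q′ = indicator-inside (_≟ q) refl
          χq′≡q : χ q′ ≡ q
          χq′≡q = indicator-outside (_≟ q) (q≢q′ ∘ sym)
          c = tabulate χ
          ¬const : ¬ IsConstant c
          ¬const = separated⇒¬IsConstant {c = c} {u = q} {v = q′} λ eq →
            q≢q′ (trans (sym χq′≡q) (trans (sym (lookup∘tabulate χ q′)) (trans (sym eq)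
                 (trans (lookup∘tabulate χ q) χq≡q′))))
          ≢id : c ≢ allFin n
          ≢id eq = q≢q′ (trans (sym (lookup-allFin q)) (trans (cong (λ c → lookup c q) (sym eq))
                        (trans (lookup∘tabulate χ q) χq≡q′)))
      in q≢q′ (sym (begin
        q′           ≡⟨ χq≡q′ ⟨
        χ q          ≡⟨ proj χ ⟨
        probe z χ    ≡⟨ cong f (trans (input-generic z ¬const ≢id)
                                      (sym (input-generic z′ ¬const ≢id))) ⟩
        probe z′ χ   ≡⟨ proj′ χ ⟩
        χ q′         ≡⟨ χq′≡q ⟩
        q            ∎))
      where open ≡-Reasoning

  idempotentPolymorphism-congruent : ∀ {k} (f : Operation H k) → IsPolymorphism H f → IsIdempotent H f →
                                     Congruent _≗_ _≡_ f
  idempotentPolymorphism-congruent f pol idem {x} {x′} x≗x′ = begin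
    f x                 ≡⟨ probe-identity x ⟨
    probe x (λ u → u)   ≡⟨ proj₂ p (λ u → u) ⟩
    proj₁ p             ≡⟨ probe-coordinates-agree (proj₂ p) (proj₂ p′) ⟩
    proj₁ p′            ≡⟨ proj₂ p′ (λ u → u) ⟨
    probe x′ (λ u → u)  ≡⟨ probe-identity x′ ⟩
    f x′                ∎
    where
    open ≡-Reasoning
    open Probe f x
    projection : ∀ {z} → x ≗ z → IsProjection H (probe z)
    projection {z} x≗z = arity-|H|-isProjection (probe z) (probe-congruent z)
                           (probe-isPolymorphism pol x≗z) (probe-isIdempotent idem z)
    p  = projection {x} (λ _ → refl)
    p′ = projection x≗x′

-- The probes have arity |H|, and beyond this bound Świerczkowski's lemma applies.
arityBound : Structure → ℕ
arityBound H = 5 + suc (size H)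

module _ (H : Structure) {a b : Univ H} (a≢b : a ≢ b)
         (none : ¬ HasNontrivialBelow H (arityBound H)) where

  smallArity-isProjection : ∀ {k} → k < arityBound H → (f : Operation H (suc k)) →
    Congruent _≗_ _≡_ f → IsPolymorphism H f → IsIdempotent H f → IsProjection H f
  smallArity-isProjection k<N f f-cong pol idem = decidable-stable (isProjection? H f f-cong) λ ¬proj →
    none (_ , k<N , f , f-cong , pol , idem , ¬proj)

  isCongruent : ∀ {k} (f : Operation H k) → IsPolymorphism H f → IsIdempotent H f → Congruent _≗_ _≡_ f
  isCongruent = idempotentPolymorphism-congruent H a≢b (smallArity-isProjection (m≤n+m _ 5))

  idempotentPolymorphism-isProjection : ∀ k (f : Operation H (suc k)) →
    IsPolymorphism H f → IsIdempotent H f → IsProjection H f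
  idempotentPolymorphism-isProjection zero f pol idem =
    smallArity-isProjection (s≤s z≤n) f (isCongruent f pol idem) pol idem
  idempotentPolymorphism-isProjection (suc k) f pol idem with suc k <? arityBound H
  ... | yes k<N = smallArity-isProjection k<N f (isCongruent f pol idem) pol idem
  ... | no k≮N  = let (s , uniform) = swierczkowski a≢b 4<K collapsing in
                  s , collapsing-projection |H|<K uniform
    where
    N≤k : arityBound H ≤ suc k
    N≤k = ≮⇒≥ k≮N
    4<K : 4 < suc (suc k)
    4<K = ≤-trans (m≤m+n 5 _) (≤-trans N≤k (n≤1+n _))
    |H|<K : suc (size H) < suc (suc k)
    |H|<K = s≤s (≤-trans (m≤n+m _ 5) N≤k)
    collapsing : PairwiseCollapsing f
    collapsing i≢j = identificationMinor-collapses H i≢j (isCongruent f pol idem)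
      (idempotentPolymorphism-isProjection k (f ∘ (_∘ identify i≢j))
        (pointwiseMinor-isPolymorphism H f (identify i≢j) (_∘ identify i≢j) (λ _ _ → refl) pol) idem)

lemma8p1 : (H : Structure) → Dec (HasNontrivialIdempotentPolymorphism H)
lemma8p1 (struct zero _) =
  no λ { (_ , f , _ , _ , ¬proj) → ¬proj (zero , λ x → singleton (f x) (x zero)) }
  where
  singleton : (u v : Fin 1) → u ≡ v
  singleton zero zero = refl
lemma8p1 H@(struct (suc _) _) = decide (hasNontrivialBelow? H (arityBound H))
  where
  decide : Dec (HasNontrivialBelow H (arityBound H)) → Dec (HasNontrivialIdempotentPolymorphism H)
  decide (yes (M , _ , f , _ , nip)) = yes (M , f , nip)
  decide (no none) = no λ { (k , f , pol , idem , ¬proj) →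
        ¬proj (idempotentPolymorphism-isProjection H {0F} {1F} (λ ()) none k f pol idem) }
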